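{- Let $g:\{0,1\}^k\to\{0,1\}$ with $PBP(g)=s$, and let $f_1,\dots,f_k$ be functions $f_i:\{0,1\}^n\times\{0,1\}^n\to\{0,1\}$ with $GH(f_i)=C_i$, where each $f_i$ is evaluated on parts of Alice's and Bob's inputs (the $f_i$ need not all have the same inputs $x,y$). Then the function $(x,y)\mapsto g(f_1,\dots,f_k)$, with Alice holding all of Alice's parts and Bob all of Bob's parts, satisfies $GH(g(f_1,\dots,f_k))=O(s\cdot\max_i C_i)+O(1)$.
   Context: Garden-hose model: Alice holds $x$, Bob holds $y$. A garden-hose protocol of size $s$ consists of a set $V$ of $s$ vertices (pipes) and an extra vertex $t$ (the tap), together with an assignment of a matching $E_A(x)$ on $V\cup\{t\}$ to every input $x$ of Alice and a matching $E_B(y)$ on $V$ to every input $y$ of Bob. In the graph $(V\cup\{t\},E_A(x)\cup E_B(y))$ every vertex has degree at most 2, so there is a unique maximal path starting at $t$; the output on $(x,y)$ is the parity of the number of edges of this path. The protocol computes a function if the output equals the function value for all inputs. $GH(h)$ is the minimum size of a garden-hose protocol computing $h$. A (loose) permutation branching program is a layered branching program: a source node in layer 0, two sink nodes labeled accept and reject, all other layers having the same number of nodes; all nodes of a layer query the same variable; each non-sink node has a 0-edge and a 1-edge going to the next layer or directly to a sink; and for each $b\in\{0,1\}$ the $b$-edges leaving a layer form an injective mapping from the nodes of that layer into the nodes of the next layer together with $\{\mathrm{accept},\mathrm{reject}\}$. An input is accepted iff its computation path reaches accept. The size is the number of nodes, and $PBP(g)$ is the minimal size of a permutation branching program computing $g$.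 -}

module Defs where

open import Data.Nat using (ℕ; zero; suc; _+_; _*_; _≤_; _⊔_)
open import Data.Nat.Properties using (_≤?_)
open import Data.Fin using (Fin; zero; suc)
open import Data.Bool using (Bool; true; false; not)
open import Data.Maybe using (Maybe; just; nothing)
open import Data.Sum using (_⊎_; inj₁; inj₂)
open import Data.Product using (Σ; _×_; _,_)
open import Relation.Nullary using (yes; no; ¬_)
open import Relation.Binary.PropositionalEquality using (_≡_)
open import Function.Definitions using (Injective)

-- Boolean inputs {0,1}^m are functions Fin m → Bool; {0,1} is Bool
-- (true = 1).

odd : ℕ → Bool
odd zero = false
odd (suc n) = not (odd n)

maxFin : ∀ {k} → (Fin k → ℕ) → ℕ
maxFin {zero} c = 0
maxFin {suc k} c = c zero ⊔ maxFin (λ i → c (suc i))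

record Matching (N : ℕ) : Set where
  field
    partner : Fin N → Maybe (Fin N)
    partner-sym : ∀ u v → partner u ≡ just v → partner v ≡ just u
    partner-irrefl : ∀ u → ¬ (partner u ≡ just u)
open Matching public

-- The vertex set V ∪ {t} is Fin (suc s), the tap t being
-- 'zero' and the pipe v ∈ V = Fin s being 'suc v'.  Alice's matchings
-- live on V ∪ {t}, Bob's on V.
record GHProtocol (X Y : Set) : Set where
  field
    size : ℕ
    alice : X → Matching (suc size)
    bob : Y → Matching size
open GHProtocol public

bobPartner : ∀ {s} → Matching s → Fin (suc s) → Maybe (Fin (suc s))
bobPartner m zero = nothing
bobPartner m (suc v) with partner m v
... | nothing = nothing
... | just w = just (suc w)

-- Length (number of edges) of the maximal path starting at the tap in
-- the graph (V ∪ {t}, E_A ∪ E_B).  Every vertex has at most one Alice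
-- edge and at most one Bob edge and t has no Bob edge, so this path is
-- the walk t, A-edge, B-edge, A-edge, ... followed until the current
-- vertex has no edge of the required owner.  The path has at most s+1
-- vertices, so the fuel s+1 is never exhausted.
-- pathLen fuel turn u : turn = true means the next edge is Alice's.
pathLen : ∀ {s} → Matching (suc s) → Matching s →
          ℕ → Bool → Fin (suc s) → ℕ
pathLen mA mB zero t u = 0
pathLen mA mB (suc f) true u with partner mA u
... | nothing = 0
... | just v = suc (pathLen mA mB f false v)
pathLen mA mB (suc f) false u with bobPartner mB u
... | nothing = 0
... | just v = suc (pathLen mA mB f true v)

ghOutput : ∀ {X Y} → (P : GHProtocol X Y) → X → Y → Bool
ghOutput P x y =
  odd (pathLen (alice P x) (bob P y) (suc (size P)) true zero)

GHComputes : ∀ {X Y} → GHProtocol X Y → (X → Y → Bool) → Set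
GHComputes P h = ∀ x y → ghOutput P x y ≡ h x y

GHis : ∀ {X Y} → (X → Y → Bool) → ℕ → Set
GHis {X} {Y} h C =
  Σ (GHProtocol X Y) (λ P → GHComputes P h × size P ≡ C)
  × (∀ (P : GHProtocol X Y) → GHComputes P h → C ≤ size P)

layerWidth : ℕ → ℕ → ℕ → ℕ
layerWidth w L zero = 1
layerWidth w L (suc j) with suc j ≤? L
... | yes _ = w
... | no _ = 0

-- The b-edges leaving layer j are given by δ j b, mapping nodes of layer
-- j (Fin (width j)) to nodes of layer j+1 or to a sink (inj₂ true =
-- accept, inj₂ false = reject); this map is injective.  For the last
-- layer L, layer L+1 is empty, so all its edges go to sinks.
record PBP (k : ℕ) : Set where
  field
    w L : ℕ
    var : (j : ℕ) → j ≤ L → Fin k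
    δ : (j : ℕ) → (p : j ≤ L) → Bool →
        Fin (layerWidth w L j) → Fin (layerWidth w L (suc j)) ⊎ Bool
    δ-injective : ∀ j p b → Injective _≡_ _≡_ (δ j p b)
open PBP public

-- number of nodes: source + L layers of width w + two sinks
pbpSize : ∀ {k} → PBP k → ℕ
pbpSize P = 1 + L P * w P + 2

pbpRun : ∀ {k} → (P : PBP k) → (Fin k → Bool) →
         ℕ → (j : ℕ) → Fin (layerWidth (w P) (L P) j) → Bool
pbpRun P z zero j u = false
pbpRun P z (suc f) j u with j ≤? L P
... | no _ = false
... | yes p with δ P j p (z (var P j p)) u
...   | inj₂ b = b
...   | inj₁ v = pbpRun P z f (suc j) v

-- accepted iff the computation path from the source reaches accept
-- (the path visits at most L+1 layers, so the fuel suffices)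
pbpEval : ∀ {k} → PBP k → (Fin k → Bool) → Bool
pbpEval P z = pbpRun P z (suc (L P)) 0 zero

PBPComputes : ∀ {k} → PBP k → ((Fin k → Bool) → Bool) → Set
PBPComputes P g = ∀ z → pbpEval P z ≡ g z

PBPis : ∀ {k} → ((Fin k → Bool) → Bool) → ℕ → Set
PBPis {k} g s =
  Σ (PBP k) (λ P → PBPComputes P g × pbpSize P ≡ s)
  × (∀ (P : PBP k) → PBPComputes P g → s ≤ pbpSize P)

-- The composed function g(f_1,…,f_k): Alice holds x ∈ {0,1}^NA, Bob
-- holds y ∈ {0,1}^NB; f_i is evaluated on the parts of x and y selected
-- by the (injective) position maps a i and b i.
compose : ∀ {k n NA NB} → ((Fin k → Bool) → Bool) →
          (Fin k → (Fin n → Bool) → (Fin n → Bool) → Bool) →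
          (Fin k → Fin n → Fin NA) → (Fin k → Fin n → Fin NB) →
          (Fin NA → Bool) → (Fin NB → Bool) → Bool
compose g f a b x y = g (λ i → f i (λ j → x (a i j)) (λ j → y (b i j)))

-- A garden-hose protocol is read as a graph whose edges alternate between Alice's and
-- Bob's matchings; its output is the parity of the maximal alternating walk from the tap,
-- and that walk never revisits a vertex. Three copies of a protocol for f_i form a gadget:
-- the walk runs through the first copy, crosses at its end into the copy named by the
-- output, and runs back to that copy's tap, an odd number of edges in all. Every node of
-- the permutation branching program for g carries such a gadget for its own variable,
-- whose output taps are wired to the successor nodes, and one for the variable of its
-- predecessors, traversed backwards, which merges the two incoming wires; injectivity of
-- the layer maps makes this wiring a matching. The walk from the tap then follows the
-- computation path of g, spending an even number of edges per step, and has odd length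
-- exactly when g accepts. The at most s nodes carry 6 (max C_i + 1) + 2 vertices each,
-- fewer than 14 s max C_i in all; when every C_i is 0 the composed function is constant.

module Submission where

open import Data.Bool using (Bool; true; false; not; _xor_; _≟_)
open import Data.Bool.Properties
  using (not-involutive; ¬-not; not-distribˡ-xor; not-distribʳ-xor; xor-same)
open import Data.Empty using (⊥-elim)
open import Data.Fin using (Fin; zero; suc; toℕ; fromℕ<; inject≤; cast)
import Data.Fin as Fin
open import Data.Fin.Properties
  using (toℕ<n; toℕ-injective; toℕ-fromℕ<; toℕ-inject≤; toℕ-cast; any?; pigeonhole
        ; +↔⊎; *↔×; 2↔Bool)
open import Data.Maybe using (Maybe; just; nothing; _<∣>_)
import Data.Maybe as Maybe
open import Data.Maybe.Properties using (just-injective)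
open import Data.Nat using (ℕ; zero; suc; _+_; _*_; _≤_; _<_; z≤n; s≤s; pred)
open import Data.Nat.Properties
  using ( ≤-refl; ≤-trans; ≤-reflexive; ≤-antisym; ≤-pred; ≤-irrelevant; <⇒≤; n≤1+n; <-cmp
        ; _<?_; _≤?_; ≮⇒≥; 1+n≰n; suc-injective; +-identityʳ; +-suc; pred[n]≤n
        ; *-monoˡ-≤; *-monoʳ-≤; +-monoˡ-≤; m≤m+n; m≤m⊔n; m≤n⊔m; n≤0⇒n≡0; *-zeroʳ
        ; module ≤-Reasoning)
open import Data.Nat.Solver using (module +-*-Solver)
open import Data.Product using (Σ; _×_; _,_; ∃-syntax; ∃₂; proj₁; proj₂)
open import Data.Product.Function.NonDependent.Propositional using (_×-↔_)
open import Data.Sum using (_⊎_; inj₁; inj₂; map₁)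
open import Data.Sum.Function.Propositional using (_⊎-↔_)
import Data.Sum.Properties as Sum
open import Function using (_∘_)
open import Function.Bundles using (_↔_; Inverse; mk↔ₛ′)
open import Function.Definitions using (Injective)
open import Function.Properties.Inverse using (↔-sym; ↔-trans; ↔-refl)
open import Relation.Binary.Definitions using (tri<; tri≈; tri>)
open import Relation.Binary.PropositionalEquality
open import Relation.Nullary using (Dec; yes; no)
open import Relation.Nullary.Decidable using (map′)
open import Defs

private variable
  A B V W X Y : Set
  s : ℕ

-- Partial matchings

record PartialMatching (V : Set) : Set where
  field
    mate        : V → Maybe V
    mate-sym    : ∀ {u v} → mate u ≡ just v → mate v ≡ just u
    mate-irrefl : ∀ {u} → mate u ≢ just u
open PartialMatching public

fromMatching : ∀ {n} → Matching n → PartialMatching (Fin n)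
fromMatching m = record
  { mate = partner m ; mate-sym = partner-sym m _ _ ; mate-irrefl = partner-irrefl m _ }

toMatching : ∀ {n} → PartialMatching (Fin n) → Matching n
toMatching M = record
  { partner = mate M ; partner-sym = λ _ _ → mate-sym M ; partner-irrefl = λ _ → mate-irrefl M }

emptyᴹ : PartialMatching A
emptyᴹ = record { mate = λ _ → nothing ; mate-sym = λ () ; mate-irrefl = λ () }

record Embedding (A B : Set) : Set where
  field
    embed         : A → B
    retract       : B → Maybe A
    retract-embed : ∀ a → retract (embed a) ≡ just a
    embed-retract : ∀ {a b} → retract b ≡ just a → embed a ≡ b
open Embedding public

module _ (e : Embedding A B) where

  embed-injective : ∀ {a a′} → embed e a ≡ embed e a′ → a ≡ a′
  embed-injective {a} {a′} eq =
    just-injective (trans (sym (retract-embed e a)) (trans (cong (retract e) eq) (retract-embed e a′)))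

  module _ (M : PartialMatching A) where

    private
      push : B → Maybe B
      push b with retract e b
      ... | nothing = nothing
      ... | just a  = Maybe.map (embed e) (mate M a)

      push-embed : ∀ a → push (embed e a) ≡ Maybe.map (embed e) (mate M a)
      push-embed a rewrite retract-embed e a = refl

    pushforward : PartialMatching B
    pushforward = record { mate = push ; mate-sym = push-sym ; mate-irrefl = push-irrefl }
      where
      open ≡-Reasoning
      push-sym : ∀ {u v} → push u ≡ just v → push v ≡ just u
      push-sym {u} eq with retract e u in r | eq
      ... | just a | _ with mate M a in m
      push-sym {u} _ | just a | refl | just a′ = begin
        push (embed e a′)               ≡⟨ push-embed a′ ⟩
        Maybe.map (embed e) (mate M a′) ≡⟨ cong (Maybe.map (embed e)) (mate-sym M m) ⟩
        just (embed e a)                ≡⟨ cong just (embed-retract e r) ⟩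
        just u                          ∎

      push-irrefl : ∀ {u} → push u ≢ just u
      push-irrefl {u} eq with retract e u in r | eq
      ... | just a | _ with mate M a in m
      push-irrefl {u} _ | just a | eq′ | just a′ =
        mate-irrefl M (trans m (cong just (embed-injective a′≡a)))
        where a′≡a = trans (just-injective eq′) (sym (embed-retract e r))

    mate-pushforward : ∀ a → mate pushforward (embed e a) ≡ Maybe.map (embed e) (mate M a)
    mate-pushforward = push-embed

  pullback : PartialMatching B → PartialMatching A
  pullback N = record { mate = pull ; mate-sym = pull-sym ; mate-irrefl = pull-irrefl }
    where
    pull : A → Maybe A
    pull a with mate N (embed e a)
    ... | nothing = nothing
    ... | just b  = retract e b

    pull-sym : ∀ {u v} → pull u ≡ just v → pull v ≡ just u
    pull-sym {u} eq with mate N (embed e u) in m | eq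
    ... | just b | r rewrite embed-retract e r | mate-sym N m = retract-embed e u

    pull-irrefl : ∀ {u} → pull u ≢ just u
    pull-irrefl {u} eq with mate N (embed e u) in m | eq
    ... | just b | r = mate-irrefl N (trans m (cong just (sym (embed-retract e r))))

inject≤-embedding : ∀ {m n} → m ≤ n → Embedding (Fin m) (Fin n)
inject≤-embedding {m} m≤n = record
  { embed = λ i → inject≤ i m≤n ; retract = restrict
  ; retract-embed = restrict-inject≤ ; embed-retract = λ {i} {j} → inject≤-restrict i j }
  where
  restrict : Fin _ → Maybe (Fin m)
  restrict j with toℕ j <? m
  ... | yes j<m = just (fromℕ< j<m)
  ... | no _    = nothing

  restrict-inject≤ : ∀ i → restrict (inject≤ i m≤n) ≡ just i
  restrict-inject≤ i with toℕ (inject≤ i m≤n) <? m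
  ... | yes i<m = cong just (toℕ-injective (trans (toℕ-fromℕ< i<m) (toℕ-inject≤ i m≤n)))
  ... | no i≮m  = ⊥-elim (i≮m (subst (_< m) (sym (toℕ-inject≤ i m≤n)) (toℕ<n i)))

  inject≤-restrict : ∀ i j → restrict j ≡ just i → inject≤ i m≤n ≡ j
  inject≤-restrict i j eq with toℕ j <? m
  inject≤-restrict _ j refl | yes j<m =
    toℕ-injective (trans (toℕ-inject≤ (fromℕ< j<m) m≤n) (toℕ-fromℕ< j<m))

suc-embedding : ∀ {n} → Embedding (Fin n) (Fin (suc n))
suc-embedding = record
  { embed = suc ; retract = λ { zero → nothing ; (suc i) → just i }
  ; retract-embed = λ _ → refl ; embed-retract = λ { {b = suc _} refl → refl } }

↔-embedding : A ↔ B → Embedding A B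
↔-embedding A↔B = record
  { embed = Inverse.to A↔B ; retract = λ b → just (Inverse.from A↔B b)
  ; retract-embed = λ a → cong just (Inverse.strictlyInverseʳ A↔B a)
  ; embed-retract = λ { refl → Inverse.strictlyInverseˡ A↔B _ } }

unionᴹ : (M N : PartialMatching A) → (∀ a → mate M a ≡ nothing ⊎ mate N a ≡ nothing) →
         PartialMatching A
unionᴹ M N disjoint = record
  { mate = λ a → mate M a <∣> mate N a ; mate-sym = union-sym ; mate-irrefl = union-irrefl }
  where
  union-sym : ∀ {u v} → mate M u <∣> mate N u ≡ just v → mate M v <∣> mate N v ≡ just u
  union-sym {u} {v} eq with mate M u in m
  ... | just _ rewrite just-injective (sym eq) | mate-sym M m = refl
  ... | nothing with disjoint v
  ...   | inj₁ Mv≡nothing rewrite Mv≡nothing = mate-sym N eq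
  ...   | inj₂ Nv≡nothing with () ← trans (sym Nv≡nothing) (mate-sym N eq)

  union-irrefl : ∀ {u} → mate M u <∣> mate N u ≢ just u
  union-irrefl {u} eq with mate M u in m
  ... | just _  = mate-irrefl M (trans m eq)
  ... | nothing = mate-irrefl N eq

_⊎ᴹ_ : PartialMatching A → PartialMatching B → PartialMatching (A ⊎ B)
M ⊎ᴹ N = record { mate = ⊎-mate ; mate-sym = ⊎-sym ; mate-irrefl = ⊎-irrefl }
  where
  ⊎-mate : _ ⊎ _ → Maybe (_ ⊎ _)
  ⊎-mate (inj₁ a) = Maybe.map inj₁ (mate M a)
  ⊎-mate (inj₂ b) = Maybe.map inj₂ (mate N b)

  ⊎-sym : ∀ {u v} → ⊎-mate u ≡ just v → ⊎-mate v ≡ just u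
  ⊎-sym {inj₁ a} eq with mate M a in m
  ⊎-sym {inj₁ a} refl | just _ rewrite mate-sym M m = refl
  ⊎-sym {inj₂ b} eq with mate N b in m
  ⊎-sym {inj₂ b} refl | just _ rewrite mate-sym N m = refl

  ⊎-irrefl : ∀ {u} → ⊎-mate u ≢ just u
  ⊎-irrefl {inj₁ a} eq with mate M a in m
  ⊎-irrefl {inj₁ a} refl | just _ = mate-irrefl M m
  ⊎-irrefl {inj₂ b} eq with mate N b in m
  ⊎-irrefl {inj₂ b} refl | just _ = mate-irrefl N m

Σᴹ : {I : Set} {F : I → Set} → (∀ i → PartialMatching (F i)) → PartialMatching (Σ I F)
Σᴹ {F = F} M = record { mate = Σ-mate ; mate-sym = Σ-sym ; mate-irrefl = Σ-irrefl }
  where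
  Σ-mate : Σ _ F → Maybe (Σ _ F)
  Σ-mate (i , a) = Maybe.map (i ,_) (mate (M i) a)

  Σ-sym : ∀ {u v} → Σ-mate u ≡ just v → Σ-mate v ≡ just u
  Σ-sym {i , a} eq with mate (M i) a in m
  Σ-sym {i , a} refl | just _ rewrite mate-sym (M i) m = refl

  Σ-irrefl : ∀ {u} → Σ-mate u ≢ just u
  Σ-irrefl {i , a} eq with mate (M i) a in m
  Σ-irrefl {i , a} refl | just _ = mate-irrefl (M i) m

any?-↔ : ∀ {n} {Q : A → Set} → A ↔ Fin n → (∀ a → Dec (Q a)) → Dec (∃[ a ] Q a)
any?-↔ {Q = Q} A↔Fin Q? =
  map′ (λ (i , q) → Inverse.from A↔Fin i , q)
       (λ (a , q) → Inverse.to A↔Fin a , subst Q (sym (Inverse.strictlyInverseʳ A↔Fin a)) q)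
       (any? (λ i → Q? (Inverse.from A↔Fin i)))

-- Alternating walks

record HoseGraph (V : Set) : Set where
  field
    aliceᴹ bobᴹ : PartialMatching V
open HoseGraph public

pushforwardᴴ : Embedding A B → HoseGraph A → HoseGraph B
pushforwardᴴ e G = record { aliceᴹ = pushforward e (aliceᴹ G) ; bobᴹ = pushforward e (bobᴹ G) }

odd-+ : ∀ m n → odd (m + n) ≡ odd m xor odd n
odd-+ zero    n = refl
odd-+ (suc m) n = trans (cong not (odd-+ m n)) (not-distribˡ-xor (odd m) (odd n))

odd-+-suc-self : ∀ n → odd (n + suc n) ≡ true
odd-+-suc-self n = begin
  odd (n + suc n)         ≡⟨ odd-+ n (suc n) ⟩
  odd n xor not (odd n)   ≡⟨ not-distribʳ-xor (odd n) (odd n) ⟨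
  not (odd n xor odd n)   ≡⟨ cong not (xor-same (odd n)) ⟩
  true                    ∎
  where open ≡-Reasoning

turnAt : Bool → ℕ → Bool
turnAt t zero    = t
turnAt t (suc n) = turnAt (not t) n

turnAt-suc : ∀ t n → turnAt t (suc n) ≡ not (turnAt t n)
turnAt-suc t zero    = refl
turnAt-suc t (suc n) = turnAt-suc (not t) n

turnAt-true : ∀ n → turnAt true n ≡ not (odd n)
turnAt-true zero    = refl
turnAt-true (suc n) = trans (turnAt-suc true n) (cong not (turnAt-true n))

module _ (G : HoseGraph V) where

  edge : Bool → V → Maybe V
  edge true  = mate (aliceᴹ G)
  edge false = mate (bobᴹ G)

  edge-sym : ∀ t {u v} → edge t u ≡ just v → edge t v ≡ just u
  edge-sym true  = mate-sym (aliceᴹ G)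
  edge-sym false = mate-sym (bobᴹ G)

  edge-irrefl : ∀ t {u} → edge t u ≢ just u
  edge-irrefl true  = mate-irrefl (aliceᴹ G)
  edge-irrefl false = mate-irrefl (bobᴹ G)

  walkLength : ℕ → Bool → V → ℕ
  walkLength zero    t u = 0
  walkLength (suc f) t u with edge t u
  ... | nothing = 0
  ... | just v  = suc (walkLength f (not t) v)

  -- Walk t u n t′ v : an alternating walk of n edges from u to v that starts with an edge
  -- of owner t (true for Alice) and after which it is t′'s turn.
  infixr 5 _∷_
  data Walk : Bool → V → ℕ → Bool → V → Set where
    []  : ∀ {t u} → Walk t u 0 t u
    _∷_ : ∀ {t u v n t′ w} → edge t u ≡ just v → Walk (not t) v n t′ w →
          Walk t u (suc n) t′ w

  record MaximalWalk (t : Bool) (u : V) (n : ℕ) : Set where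
    constructor maximal
    field
      {lastTurn} : Bool
      {last}     : V
      walk       : Walk t u n lastTurn last
      stuck      : edge lastTurn last ≡ nothing

  private variable
    t : Bool
    u : V
    n f : ℕ

  walkLength-maximal : MaximalWalk t u n → n ≤ f → walkLength f t u ≡ n
  walkLength-maximal {f = zero}  (maximal []      _)     _         = refl
  walkLength-maximal {f = suc f} (maximal []      stuck) _         rewrite stuck = refl
  walkLength-maximal {f = suc f} (maximal (e ∷ p) stuck) (s≤s n≤f) rewrite e =
    cong suc (walkLength-maximal (maximal p stuck) n≤f)

  walkLength-walk : ∀ f t u → ∃₂ λ t′ v → Walk t u (walkLength f t u) t′ v
  walkLength-walk zero    t u = t , u , []
  walkLength-walk (suc f) t u with edge t u in e
  ... | nothing = t , u , []
  ... | just v with walkLength-walk f (not t) v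
  ...   | t′ , v′ , p = t′ , v′ , e ∷ p

  maximalWalk-walkLength : ∀ f t u → walkLength f t u < f → MaximalWalk t u (walkLength f t u)
  maximalWalk-walkLength (suc f) t u l<f with edge t u in e
  ... | nothing = maximal [] e
  ... | just v with maximalWalk-walkLength f (not t) v (≤-pred l<f)
  ...   | maximal p stuck = maximal (e ∷ p) stuck

module _ {G : HoseGraph V} where

  private variable
    t t′ t″ : Bool
    u v v′ : V
    m n : ℕ

  infixr 5 _++_
  _++_ : Walk G t u m t′ v → Walk G t′ v n t″ v′ → Walk G t u (m + n) t″ v′
  []      ++ q = q
  (e ∷ p) ++ q = e ∷ (p ++ q)

  infixl 5 _∷ʳ_
  _∷ʳ_ : Walk G t u n t′ v → edge G t′ v ≡ just v′ → Walk G t u (suc n) (not t′) v′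
  []       ∷ʳ e = e ∷ []
  (e′ ∷ p) ∷ʳ e = e′ ∷ (p ∷ʳ e)

  reverse : Walk G t u n t′ v → Walk G (not t′) v n (not t) u
  reverse []                    = []
  reverse (_∷_ {t = true} e p)  = reverse p ∷ʳ edge-sym G true e
  reverse (_∷_ {t = false} e p) = reverse p ∷ʳ edge-sym G false e

  lastTurn-turnAt : Walk G t u n t′ v → t′ ≡ turnAt t n
  lastTurn-turnAt []      = refl
  lastTurn-turnAt (_ ∷ p) = lastTurn-turnAt p

  walk-parity : Walk G true u n t′ v → odd n ≡ not t′
  walk-parity {n = n} {t′ = t′} p = begin
    odd n               ≡⟨ not-involutive (odd n) ⟨
    not (not (odd n))   ≡⟨ cong not (turnAt-true n) ⟨
    not (turnAt true n) ≡⟨ cong not (lastTurn-turnAt p) ⟨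
    not t′              ∎
    where open ≡-Reasoning

module FromTap (G : HoseGraph V) (tap : V) (bob-tap : mate (bobᴹ G) tap ≡ nothing) where

  private variable
    t t′ : Bool
    u v : V
    n : ℕ

  vertexAt : Walk G t u n t′ v → ℕ → V
  vertexAt {u = u} p       zero    = u
  vertexAt {u = u} []      (suc k) = u
  vertexAt         (_ ∷ p) (suc k) = vertexAt p k

  vertexAt-last : (p : Walk G t u n t′ v) → vertexAt p n ≡ v
  vertexAt-last []          = refl
  vertexAt-last (_ ∷ [])    = refl
  vertexAt-last (_ ∷ e ∷ p) = vertexAt-last (e ∷ p)

  vertexAt-edge : (p : Walk G t u n t′ v) → ∀ k → k < n →
                  edge G (turnAt t k) (vertexAt p k) ≡ just (vertexAt p (suc k))
  vertexAt-edge (e ∷ [])    zero    _         = e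
  vertexAt-edge (e ∷ _ ∷ _) zero    _         = e
  vertexAt-edge (_ ∷ p)     (suc k) (s≤s k<n) = vertexAt-edge p k k<n

  module _ (p : Walk G true tap n t′ v) where

    private
      x : ℕ → V
      x = vertexAt p

      turn : ℕ → Bool
      turn = turnAt true

      forward : ∀ k → k < n → edge G (turn k) (x k) ≡ just (x (suc k))
      forward = vertexAt-edge p

      backward : ∀ k → k < n → edge G (turn k) (x (suc k)) ≡ just (x k)
      backward k k<n = edge-sym G (turn k) (forward k k<n)

      functional : ∀ t {a b c} → edge G t a ≡ just b → edge G t a ≡ just c → b ≡ c
      functional _ e e′ = just-injective (trans (sym e) e′)

      turn-suc-suc : ∀ k → turn (suc (suc k)) ≡ turn k
      turn-suc-suc k = trans (turnAt-suc true (suc k))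
                             (trans (cong not (turnAt-suc true k)) (not-involutive (turn k)))

      bob-avoids-tap : ∀ k → k < n → tap ≡ x (suc k) → turn k ≢ false
      bob-avoids-tap k k<n tap≡x tk with () ←
        trans (sym bob-tap)
              (subst₂ (λ b a → edge G b a ≡ just (x k)) tk (sym tap≡x) (backward k k<n))

      arrive : ∀ {i j} → j < n → x (suc i) ≡ x (suc j) →
               edge G (turn j) (x (suc i)) ≡ just (x j)
      arrive {j = j} j<n xi≡xj =
        subst (λ a → edge G (turn j) a ≡ just (x j)) (sym xi≡xj) (backward j j<n)

    -- Matchings are functional, so equal vertices at positions i < j force equal vertices at
    -- i - 1 < j - 1 (equal turns) or at i + 1 < j - 1 (opposite turns); the tap could only be
    -- re-entered along its Alice edge, which the walk used first.
    vertexAt-injective : ∀ j i → i < j → j ≤ n → x i ≢ x j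
    vertexAt-injective 1 0 _ 1≤n tap≡x₁ =
      edge-irrefl G true (trans (forward 0 1≤n) (cong just (sym tap≡x₁)))
    vertexAt-injective 2 0 _ 2≤n tap≡x₂ = bob-avoids-tap 1 2≤n tap≡x₂ refl
    vertexAt-injective (suc (suc (suc j))) 0 _ j<n tap≡x =
      vertexAt-injective (suc (suc j)) 1 (s≤s (s≤s z≤n)) (≤-trans (n≤1+n _) j<n)
        (functional true (forward 0 (≤-trans (s≤s z≤n) j<n)) alice-into-tap)
      where
      alice-into-tap : edge G true tap ≡ just (x (suc (suc j)))
      alice-into-tap = subst₂ (λ b a → edge G b a ≡ just (x (suc (suc j))))
        (¬-not (bob-avoids-tap (suc (suc j)) j<n tap≡x)) (sym tap≡x) (backward (suc (suc j)) j<n)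
    vertexAt-injective (suc j) (suc i) (s≤s i<j) j<n xi≡xj with turn j ≟ turn i
    ... | yes same =
      vertexAt-injective j i i<j j≤n
        (functional (turn i) (backward i (≤-trans i<j j≤n))
                    (subst (λ b → edge G b _ ≡ _) same (arrive j<n xi≡xj)))
      where j≤n = ≤-trans (n≤1+n j) j<n
    ... | no differ
      with <-cmp (suc (suc i)) j
         | functional (turn (suc i)) (forward (suc i) (≤-trans (s≤s i<j) j<n))
             (subst (λ b → edge G b _ ≡ _) (trans (¬-not differ) (sym (turnAt-suc true i)))
                    (arrive j<n xi≡xj))
    ...   | tri< i+2<j _ _ | x[i+2]≡xj =
      vertexAt-injective j (suc (suc i)) i+2<j (≤-trans (n≤1+n j) j<n) x[i+2]≡xj
    ...   | tri≈ _ refl _  | _ = differ (turn-suc-suc i)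
    ...   | tri> _ _ j<i+2 | x[i+2]≡xj with ≤-antisym (≤-pred j<i+2) i<j
    ...     | refl = edge-irrefl G (turn (suc i)) (trans (forward (suc i) j<n) (cong just x[i+2]≡xj))

  walk-length< : ∀ {K} (enc : V → Fin K) → Injective _≡_ _≡_ enc →
                 Walk G true tap n t′ v → n < K
  walk-length< {n = n} {K = K} enc enc-injective p with n <? K
  ... | yes n<K = n<K
  ... | no n≮K with pigeonhole (s≤s (≮⇒≥ n≮K)) (λ k → enc (vertexAt p (toℕ k)))
  ...   | i , j , i<j , same-code =
    ⊥-elim (vertexAt-injective p (toℕ j) (toℕ i) i<j (≤-pred (toℕ<n j)) (enc-injective same-code))

  walk-to-tap : Walk G true tap n t′ tap → n ≡ 0
  walk-to-tap {zero}  p = refl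
  walk-to-tap {suc n} p =
    ⊥-elim (vertexAt-injective p (suc n) 0 (s≤s z≤n) ≤-refl (sym (vertexAt-last p)))

module _ {G : HoseGraph V} {H : HoseGraph W} (h : V → W)
         (hom : ∀ t {u v} → edge G t u ≡ just v → edge H t (h u) ≡ just (h v)) where

  mapWalk : ∀ {t u n t′ v} → Walk G t u n t′ v → Walk H t (h u) n t′ (h v)
  mapWalk []                = []
  mapWalk (_∷_ {t = t} e p) = hom t e ∷ mapWalk p

module _ (e : Embedding A B) (G : HoseGraph A) where

  edge-pushforward : ∀ t a →
                     edge (pushforwardᴴ e G) t (embed e a) ≡ Maybe.map (embed e) (edge G t a)
  edge-pushforward true  = mate-pushforward e (aliceᴹ G)
  edge-pushforward false = mate-pushforward e (bobᴹ G)

  maximalWalk-pushforward : ∀ {t u n} → MaximalWalk G t u n →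
                            MaximalWalk (pushforwardᴴ e G) t (embed e u) n
  maximalWalk-pushforward (maximal {t} {v} p stuck) =
    maximal (mapWalk (embed e) (λ t {u} → trans (edge-pushforward t u) ∘ cong (Maybe.map (embed e))) p)
            (trans (edge-pushforward t v) (cong (Maybe.map (embed e)) stuck))

-- Garden-hose protocols as graphs

liftMatching : Matching s → PartialMatching (Fin (suc s))
liftMatching m = pushforward suc-embedding (fromMatching m)

bobPartner-lift : ∀ (m : Matching s) u → bobPartner m u ≡ mate (liftMatching m) u
bobPartner-lift m zero = refl
bobPartner-lift m (suc v) with partner m v
... | nothing = refl
... | just _  = refl

bobPartner-pullback : (N : PartialMatching (Fin (suc s))) → mate N zero ≡ nothing →
                      ∀ u → bobPartner (toMatching (pullback suc-embedding N)) u ≡ mate N u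
bobPartner-pullback N tap-free zero = sym tap-free
bobPartner-pullback N tap-free (suc v) with mate N (suc v) in m
... | nothing     = refl
... | just (suc _) = refl
... | just zero with () ← trans (sym tap-free) (mate-sym N m)

pathLen-walkLength : (mA : Matching (suc s)) (mB : Matching s) (B : PartialMatching (Fin (suc s))) →
                     (∀ u → bobPartner mB u ≡ mate B u) →
                     ∀ f t u → pathLen mA mB f t u ≡
                               walkLength (record { aliceᴹ = fromMatching mA ; bobᴹ = B }) f t u
pathLen-walkLength mA mB B agree zero    t     u = refl
pathLen-walkLength mA mB B agree (suc f) true  u with partner mA u
... | nothing = refl
... | just v  = cong suc (pathLen-walkLength mA mB B agree f false v)
pathLen-walkLength mA mB B agree (suc f) false u rewrite agree u with mate B u
... | nothing = refl
... | just v  = cong suc (pathLen-walkLength mA mB B agree f true v)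

protocolGraph : (P : GHProtocol X Y) → X → Y → HoseGraph (Fin (suc (size P)))
protocolGraph P x y = record { aliceᴹ = fromMatching (alice P x) ; bobᴹ = liftMatching (bob P y) }

protocolWalk : (P : GHProtocol X Y) (x : X) (y : Y) →
               ∃[ n ] MaximalWalk (protocolGraph P x y) true zero n × ghOutput P x y ≡ odd n
protocolWalk P x y =
  ℓ , maximalWalk-walkLength G (suc (size P)) true zero ℓ<fuel , cong odd ℓ-pathLen
  where
  G = protocolGraph P x y
  ℓ = walkLength G (suc (size P)) true zero
  ℓ-pathLen : pathLen (alice P x) (bob P y) (suc (size P)) true zero ≡ ℓ
  ℓ-pathLen = pathLen-walkLength (alice P x) (bob P y) _ (bobPartner-lift (bob P y)) _ true zero
  ℓ<fuel : ℓ < suc (size P)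
  ℓ<fuel with walkLength-walk G (suc (size P)) true zero
  ... | _ , _ , p = FromTap.walk-length< G zero refl (λ u → u) (λ eq → eq) p

module Realization (index : V ↔ Fin (suc s)) (tap : V) (index-tap : Inverse.to index tap ≡ zero)
                   (A : X → PartialMatching V) (B : Y → PartialMatching V)
                   (bob-tap : ∀ y → mate (B y) tap ≡ nothing) where

  graph : X → Y → HoseGraph V
  graph x y = record { aliceᴹ = A x ; bobᴹ = B y }

  private
    e = ↔-embedding index

    B-tap-free : ∀ y → mate (pushforward e (B y)) zero ≡ nothing
    B-tap-free y = subst (λ a → mate (pushforward e (B y)) a ≡ nothing) index-tap
                         (trans (mate-pushforward e (B y) tap) (cong (Maybe.map (embed e)) (bob-tap y)))

  protocol : GHProtocol X Y
  protocol = record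
    { size  = s
    ; alice = λ x → toMatching (pushforward e (A x))
    ; bob   = λ y → toMatching (pullback suc-embedding (pushforward e (B y))) }

  ghOutput-protocol : ∀ {x y n} → MaximalWalk (graph x y) true tap n →
                      ghOutput protocol x y ≡ odd n
  ghOutput-protocol {x} {y} {n} w = cong odd (begin
    pathLen (alice protocol x) (bob protocol y) (suc s) true zero
      ≡⟨ pathLen-walkLength _ _ _ (bobPartner-pullback _ (B-tap-free y)) (suc s) true zero ⟩
    walkLength (pushforwardᴴ e (graph x y)) (suc s) true zero
      ≡⟨ cong (walkLength _ (suc s) true) (sym index-tap) ⟩
    walkLength (pushforwardᴴ e (graph x y)) (suc s) true (Inverse.to index tap)
      ≡⟨ walkLength-maximal _ (maximalWalk-pushforward e (graph x y) w) (<⇒≤ n<fuel) ⟩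
    n ∎)
    where
    open ≡-Reasoning
    n<fuel : n < suc s
    n<fuel = FromTap.walk-length< (graph x y) tap (bob-tap y) (embed e) (embed-injective e)
                                  (MaximalWalk.walk w)

-- The three-copy gadget

data Copy : Set where
  run : Copy
  out : Bool → Copy

Copy↔Fin : Copy ↔ Fin 3
Copy↔Fin = mk↔ₛ′ to from to-from from-to
  where
  to : Copy → Fin 3
  to run         = zero
  to (out true)  = suc zero
  to (out false) = suc (suc zero)

  from : Fin 3 → Copy
  from zero             = run
  from (suc zero)       = out true
  from (suc (suc zero)) = out false

  to-from : ∀ i → to (from i) ≡ i
  to-from zero             = refl
  to-from (suc zero)       = refl
  to-from (suc (suc zero)) = refl

  from-to : ∀ c → from (to c) ≡ c
  from-to run         = refl
  from-to (out true)  = refl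
  from-to (out false) = refl

bridgeCopy : Bool → Copy → Maybe Copy
bridgeCopy b     run         = just (out b)
bridgeCopy false (out false) = just run
bridgeCopy true  (out true)  = just run
bridgeCopy _     _           = nothing

bridgeCopy-sym : ∀ b {c c′} → bridgeCopy b c ≡ just c′ → bridgeCopy b c′ ≡ just c
bridgeCopy-sym false {run}       refl = refl
bridgeCopy-sym true  {run}       refl = refl
bridgeCopy-sym false {out false} refl = refl
bridgeCopy-sym true  {out true}  refl = refl

bridgeCopy-irrefl : ∀ b {c} → bridgeCopy b c ≢ just c
bridgeCopy-irrefl false {out false} ()
bridgeCopy-irrefl true  {out true}  ()

tripled : Bool → (V → Bool) → PartialMatching V → PartialMatching (Copy × V)
tripled {V} b bridged M = record { mate = tri ; mate-sym = tri-sym ; mate-irrefl = tri-irrefl }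
  where
  tri : Copy × V → Maybe (Copy × V)
  tri (c , a) with mate M a | bridged a
  ... | just a′ | _     = just (c , a′)
  ... | nothing | true  = Maybe.map (_, a) (bridgeCopy b c)
  ... | nothing | false = nothing

  tri-sym : ∀ {u v} → tri u ≡ just v → tri v ≡ just u
  tri-sym {c , a} eq with mate M a in m | bridged a in br
  tri-sym {c , a} refl | just a′ | _ rewrite mate-sym M m = refl
  tri-sym {c , a} eq | nothing | true with bridgeCopy b c in bc
  tri-sym {c , a} refl | nothing | true | just c′ rewrite m | br | bridgeCopy-sym b bc = refl

  tri-irrefl : ∀ {u} → tri u ≢ just u
  tri-irrefl {c , a} eq with mate M a in m | bridged a
  tri-irrefl {c , a} refl | just a′ | _ = mate-irrefl M m
  tri-irrefl {c , a} eq | nothing | true with bridgeCopy b c in bc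
  tri-irrefl {c , a} refl | nothing | true | just c′ = bridgeCopy-irrefl b bc

module _ (b : Bool) (bridged : V → Bool) (M : PartialMatching V) where

  mate-tripled : ∀ c {a a′} → mate M a ≡ just a′ →
                 mate (tripled b bridged M) (c , a) ≡ just (c , a′)
  mate-tripled c {a} eq with mate M a | bridged a
  mate-tripled c refl | just _ | _ = refl

  mate-tripled-bridge : ∀ {a} → mate M a ≡ nothing → bridged a ≡ true →
                        mate (tripled b bridged M) (run , a) ≡ just (out b , a)
  mate-tripled-bridge {a} unmatched isBridged with mate M a | bridged a
  mate-tripled-bridge refl refl | nothing | true = refl

isSuc : ∀ {n} → Fin n → Bool
isSuc zero    = false
isSuc (suc _) = true

gadgetAlice : PartialMatching V → PartialMatching (Copy × V)
gadgetAlice = tripled false (λ _ → true)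

gadgetBob : ∀ {M} → PartialMatching (Fin (suc M)) → PartialMatching (Copy × Fin (suc M))
gadgetBob = tripled true isSuc

gadgetBob-port : ∀ {M} (B : PartialMatching (Fin (suc M))) → mate B zero ≡ nothing →
                 ∀ c → mate (gadgetBob B) (c , zero) ≡ nothing
gadgetBob-port B tap-free c with mate B zero
... | nothing = refl

gadgetGraph : ∀ {M} → HoseGraph (Fin (suc M)) → HoseGraph (Copy × Fin (suc M))
gadgetGraph H = record { aliceᴹ = gadgetAlice (aliceᴹ H) ; bobᴹ = gadgetBob (bobᴹ H) }

module _ {M} (H : HoseGraph (Fin (suc M))) (bob-tap : mate (bobᴹ H) zero ≡ nothing) where

  gadget-traversal : ∀ {n} → MaximalWalk H true zero n →
                ∃[ m ] Walk (gadgetGraph H) true (run , zero) m false (out (odd n) , zero)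
                     × odd m ≡ true
  gadget-traversal {n} (maximal {t} {v} p stuck) = n + suc n , cross t v p stuck , odd-+-suc-self n
    where
    inCopy : ∀ c {t u n t′ v} → Walk H t u n t′ v → Walk (gadgetGraph H) t (c , u) n t′ (c , v)
    inCopy c = mapWalk (c ,_) λ
      { true  → mate-tripled false (λ _ → true) (aliceᴹ H) c
      ; false → mate-tripled true isSuc (bobᴹ H) c }

    cross : ∀ t v → Walk H true zero n t v → edge H t v ≡ nothing →
            Walk (gadgetGraph H) true (run , zero) (n + suc n) false (out (odd n) , zero)
    cross true v p stuck rewrite walk-parity p =
      inCopy run p ++ (mate-tripled-bridge false (λ _ → true) (aliceᴹ H) stuck refl
                       ∷ inCopy (out false) (reverse p))
    cross false (suc v) p stuck rewrite walk-parity p =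
      inCopy run p ++ (mate-tripled-bridge true isSuc (bobᴹ H) stuck refl
                       ∷ inCopy (out true) (reverse p))
    cross false zero p _ with walk-parity p | FromTap.walk-to-tap H zero bob-tap p
    ... | odd≡true | refl with () ← odd≡true

-- Permutation branching programs

module Nodes {k} (P : PBP k) where

  width : ℕ → ℕ
  width = layerWidth (w P) (L P)

  inner-width : ∀ {j} → suc j ≤ L P → width (suc j) ≡ w P
  inner-width {j} j<L with suc j ≤? L P
  ... | yes _   = refl
  ... | no j≮L = ⊥-elim (j≮L j<L)

  inner-layer : ∀ {j} → Fin (width (suc j)) → suc j ≤ L P
  inner-layer {j} v with suc j ≤? L P
  inner-layer v  | yes j<L = j<L
  inner-layer () | no _

  cast-injective : ∀ {m n} .{eq eq′ : m ≡ n} {a b : Fin m} → cast eq a ≡ cast eq′ b → a ≡ b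
  cast-injective {eq = eq} {eq′} {a} {b} same =
    toℕ-injective (trans (sym (toℕ-cast eq a)) (trans (cong toℕ same) (toℕ-cast eq′ b)))

  -- node l u is node u of layer suc (toℕ l); the layers after layer 0 all have width w.
  data Node : Set where
    source : Node
    node   : Fin (L P) → Fin (w P) → Node

  layer : Node → ℕ
  layer source     = 0
  layer (node l _) = suc (toℕ l)

  layer-≤ : ∀ ν → layer ν ≤ L P
  layer-≤ source     = z≤n
  layer-≤ (node l _) = toℕ<n l

  position : ∀ ν → Fin (width (layer ν))
  position source     = zero
  position (node l u) = cast (sym (inner-width (toℕ<n l))) u

  toNode : ∀ j → Fin (width (suc j)) → Node
  toNode j v = node (fromℕ< (inner-layer v)) (cast (inner-width (inner-layer v)) v)

  δN : Node → Bool → Node ⊎ Bool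
  δN ν b = map₁ (toNode (layer ν)) (δ P (layer ν) (layer-≤ ν) b (position ν))

  nodeVar : Node → Fin k
  nodeVar ν = var P (layer ν) (layer-≤ ν)

  -- the variable queried by the predecessors of a node (arbitrary for the source)
  mergeVar : Node → Fin k
  mergeVar source     = nodeVar source
  mergeVar (node l _) = var P (toℕ l) (<⇒≤ (toℕ<n l))

  δN-successor : ∀ {μ b ν} → δN μ b ≡ inj₁ ν →
                 ∃[ v ] δ P (layer μ) (layer-≤ μ) b (position μ) ≡ inj₁ v
                      × toNode (layer μ) v ≡ ν
  δN-successor {μ} {b} μ→ν with δ P (layer μ) (layer-≤ μ) b (position μ)
  δN-successor refl | inj₁ v = v , refl , refl

  layer-δN : ∀ {μ b ν} → δN μ b ≡ inj₁ ν → layer ν ≡ suc (layer μ)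
  layer-δN μ→ν with δN-successor μ→ν
  ... | v , _ , refl = cong suc (toℕ-fromℕ< (inner-layer v))

  mergeVar-δN : ∀ {μ b ν} → δN μ b ≡ inj₁ ν → mergeVar ν ≡ nodeVar μ
  mergeVar-δN μ→ν with δN-successor μ→ν
  ... | v , _ , refl = var-cong (toℕ-fromℕ< (inner-layer v))
    where
    var-cong : ∀ {i j} {p q} → i ≡ j → var P i p ≡ var P j q
    var-cong {p = p} {q} refl = cong (var P _) (≤-irrelevant p q)

  node-injectiveʳ : ∀ {l l′ u u′} → node l u ≡ node l′ u′ → u ≡ u′
  node-injectiveʳ refl = refl

  δN-injective : ∀ {μ μ′ b ν} → δN μ b ≡ inj₁ ν → δN μ′ b ≡ inj₁ ν → μ ≡ μ′
  δN-injective {μ} {μ′} μ→ν μ′→ν =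
    same-node μ μ′ (suc-injective (trans (sym (layer-δN μ→ν)) (layer-δN μ′→ν))) μ→ν μ′→ν
    where
    same-node : ∀ μ μ′ {b ν} → layer μ ≡ layer μ′ →
                δN μ b ≡ inj₁ ν → δN μ′ b ≡ inj₁ ν → μ ≡ μ′
    same-node source     source       _   _ _ = refl
    same-node (node l u) (node l′ u′) eq μ→ν μ′→ν with refl ← toℕ-injective (suc-injective eq)
      with δN-successor μ→ν | δN-successor μ′→ν
    ... | v , δu , refl | v′ , δu′ , same =
      cong (node l) (cast-injective (δ-injective P _ _ _ (trans δu (trans (cong inj₁ v≡v′) (sym δu′)))))
      where v≡v′ = cast-injective (node-injectiveʳ (sym same))

  module Run (z : Fin k → Bool) where

    runFrom : ℕ → Node → Bool
    runFrom f ν = pbpRun P z f (layer ν) (position ν)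

    pbpRun-toNode : ∀ f j v → pbpRun P z f (suc j) v ≡ runFrom f (toNode j v)
    pbpRun-toNode f j v =
      same-run (sym (toℕ-fromℕ< j<L)) (trans (toℕ-cast _ (cast (inner-width j<L) v)) (toℕ-cast _ v))
      where
      j<L = inner-layer v

      same-run : ∀ {j′} {c : Fin (width (suc j′))} → j ≡ j′ → toℕ c ≡ toℕ v →
                 pbpRun P z f (suc j) v ≡ pbpRun P z f (suc j′) c
      same-run refl eq = cong (pbpRun P z f (suc j)) (toℕ-injective (sym eq))

    resume : ℕ → Node ⊎ Bool → Bool
    resume f (inj₁ ν) = runFrom f ν
    resume f (inj₂ b) = b

    runFrom-suc : ∀ f ν → runFrom (suc f) ν ≡ resume f (δN ν (z (nodeVar ν)))
    runFrom-suc f ν with layer ν ≤? L P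
    ... | no ≰L = ⊥-elim (≰L (layer-≤ ν))
    ... | yes ≤L rewrite ≤-irrelevant ≤L (layer-≤ ν)
      with δ P (layer ν) (layer-≤ ν) (z (nodeVar ν)) (position ν)
    ...   | inj₂ _ = refl
    ...   | inj₁ v = pbpRun-toNode f (layer ν) v

  Node↔Fin : Node ↔ Fin (1 + L P * w P)
  Node↔Fin = ↔-trans (mk↔ₛ′ split merge split-merge merge-split)
                     (↔-trans (↔-refl ⊎-↔ ↔-sym *↔×) (↔-sym +↔⊎))
    where
    split : Node → Fin 1 ⊎ (Fin (L P) × Fin (w P))
    split source     = inj₁ zero
    split (node l u) = inj₂ (l , u)

    merge : Fin 1 ⊎ (Fin (L P) × Fin (w P)) → Node
    merge (inj₁ _)       = source
    merge (inj₂ (l , u)) = node l u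

    split-merge : ∀ c → split (merge c) ≡ c
    split-merge (inj₁ zero) = refl
    split-merge (inj₂ _)    = refl

    merge-split : ∀ ν → merge (split ν) ≡ ν
    merge-split source     = refl
    merge-split (node _ _) = refl

  predecessor? : ∀ ν b → Dec (∃[ μ ] δN μ b ≡ inj₁ ν)
  predecessor? ν b = any?-↔ Node↔Fin (λ μ → Sum.≡-dec _≟ᴺ_ _≟_ (δN μ b) (inj₁ ν))
    where
    _≟ᴺ_ : (μ ν : Node) → Dec (μ ≡ ν)
    μ ≟ᴺ ν = map′ (embed-injective (↔-embedding Node↔Fin)) (cong (Inverse.to Node↔Fin))
                  (Inverse.to Node↔Fin μ Fin.≟ Inverse.to Node↔Fin ν)

-- The composed protocol

module Composition {X Y : Set} {k} (P : PBP k) (M : ℕ) (Pr : Fin k → GHProtocol X Y)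
                   (size≤ : ∀ i → size (Pr i) ≤ M) where

  open Nodes P

  private
    padding : ∀ i → Embedding (Fin (suc (size (Pr i)))) (Fin (suc M))
    padding i = inject≤-embedding (s≤s (size≤ i))

  paddedAlice : Fin k → X → PartialMatching (Fin (suc M))
  paddedAlice i x = pushforward (padding i) (fromMatching (alice (Pr i) x))

  paddedBob : Fin k → Y → PartialMatching (Fin (suc M))
  paddedBob i y = pushforward (padding i) (liftMatching (bob (Pr i) y))

  paddedBob-tap : ∀ i y → mate (paddedBob i y) zero ≡ nothing
  paddedBob-tap i y = mate-pushforward (padding i) (liftMatching (bob (Pr i) y)) zero

  paddedGraph : Fin k → X → Y → HoseGraph (Fin (suc M))
  paddedGraph i x y = record { aliceᴹ = paddedAlice i x ; bobᴹ = paddedBob i y }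

  paddedWalk : ∀ i x y →
               ∃[ n ] MaximalWalk (paddedGraph i x y) true zero n × ghOutput (Pr i) x y ≡ odd n
  paddedWalk i x y with protocolWalk (Pr i) x y
  ... | n , w , output = n , maximalWalk-pushforward (padding i) (protocolGraph (Pr i) x y) w , output

  -- Per node: a query gadget for its variable, a merge gadget for the variable of its
  -- predecessors, and vertices rejecting b lengthening the path by one edge when the
  -- b-edge of the node rejects.
  Block : Set
  Block = (Copy × Fin (suc M)) ⊎ (Copy × Fin (suc M)) ⊎ Bool

  pattern query c a   = inj₁ (c , a)
  pattern merge c a   = inj₂ (inj₁ (c , a))
  pattern rejecting b = inj₂ (inj₂ b)

  Vertex : Set
  Vertex = Node × Block

  tap : Vertex
  tap = source , query run zero

  gadgetsAlice : X → PartialMatching Vertex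
  gadgetsAlice x = Σᴹ λ ν →
    gadgetAlice (paddedAlice (nodeVar ν) x)
      ⊎ᴹ (gadgetAlice (paddedAlice (mergeVar ν) x) ⊎ᴹ emptyᴹ)

  gadgetsBob : Y → PartialMatching Vertex
  gadgetsBob y = Σᴹ λ ν →
    gadgetBob (paddedBob (nodeVar ν) y)
      ⊎ᴹ (gadgetBob (paddedBob (mergeVar ν) y) ⊎ᴹ emptyᴹ)

  exitPort : Node → Bool → Node ⊎ Bool → Maybe Vertex
  exitPort ν b (inj₁ ν′)    = just (ν′ , merge (out b) zero)
  exitPort ν b (inj₂ true)  = nothing
  exitPort ν b (inj₂ false) = just (ν , rejecting b)

  rejectPort : Node → Bool → Node ⊎ Bool → Maybe Vertex
  rejectPort ν b (inj₂ false) = just (ν , query (out b) zero)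
  rejectPort ν b (inj₁ _)     = nothing
  rejectPort ν b (inj₂ true)  = nothing

  entryPort : ∀ {ν} b → Dec (∃[ μ ] δN μ b ≡ inj₁ ν) → Maybe Vertex
  entryPort b (yes (μ , _)) = just (μ , query (out b) zero)
  entryPort b (no _)        = nothing

  -- The run port of the query gadget of the source is the tap, which has no Bob edge.
  exceptAtSource : Node → Block → Maybe Vertex
  exceptAtSource source     _   = nothing
  exceptAtSource (node l u) blk = just (node l u , blk)

  wire : Vertex → Maybe Vertex
  wire (ν , query _       (suc _)) = nothing
  wire (ν , merge _       (suc _)) = nothing
  wire (ν , query run     zero)    = exceptAtSource ν (merge run zero)
  wire (ν , query (out b) zero)    = exitPort ν b (δN ν b)
  wire (ν , merge run     zero)    = exceptAtSource ν (query run zero)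
  wire (ν , merge (out b) zero)    = entryPort b (predecessor? ν b)
  wire (ν , rejecting b)           = rejectPort ν b (δN ν b)

  exit-sym : ∀ ν b {r v} → δN ν b ≡ r → exitPort ν b r ≡ just v →
             wire v ≡ just (ν , query (out b) zero)
  exit-sym ν b {inj₁ ν′} ν→ν′ refl with predecessor? ν′ b
  ... | yes (μ , μ→ν′) rewrite δN-injective μ→ν′ ν→ν′ = refl
  ... | no no-predecessor = ⊥-elim (no-predecessor (ν , ν→ν′))
  exit-sym ν b {inj₂ false} ν→ refl rewrite ν→ = refl

  reject-sym : ∀ ν b {r v} → δN ν b ≡ r → rejectPort ν b r ≡ just v →
               wire v ≡ just (ν , rejecting b)
  reject-sym ν b {inj₂ false} ν→ refl rewrite ν→ = refl

  wire-sym : ∀ {u v} → wire u ≡ just v → wire v ≡ just u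
  wire-sym {_        , query _ (suc _)}    ()
  wire-sym {_        , merge _ (suc _)}    ()
  wire-sym {node l u , query run zero}     refl = refl
  wire-sym {ν        , query (out b) zero} eq   = exit-sym ν b refl eq
  wire-sym {node l u , merge run zero}     refl = refl
  wire-sym {ν        , merge (out b) zero} eq with predecessor? ν b
  wire-sym {ν        , merge (out b) zero} refl | yes (μ , μ→ν) rewrite μ→ν = refl
  wire-sym {ν        , rejecting b}        eq   = reject-sym ν b refl eq

  exit-irrefl : ∀ ν b r → exitPort ν b r ≢ just (ν , query (out b) zero)
  exit-irrefl ν b (inj₁ _)     ()
  exit-irrefl ν b (inj₂ false) ()

  reject-irrefl : ∀ ν b r → rejectPort ν b r ≢ just (ν , rejecting b)
  reject-irrefl ν b (inj₂ false) ()

  wire-irrefl : ∀ {u} → wire u ≢ just u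
  wire-irrefl {_        , query _ (suc _)}    ()
  wire-irrefl {_        , merge _ (suc _)}    ()
  wire-irrefl {node l u , query run zero}     ()
  wire-irrefl {ν        , query (out b) zero} = exit-irrefl ν b (δN ν b)
  wire-irrefl {node l u , merge run zero}     ()
  wire-irrefl {ν        , merge (out b) zero} eq with predecessor? ν b
  wire-irrefl {ν        , merge (out b) zero} () | yes _
  wire-irrefl {ν        , rejecting b}        = reject-irrefl ν b (δN ν b)

  wiring : PartialMatching Vertex
  wiring = record { mate = wire ; mate-sym = wire-sym ; mate-irrefl = wire-irrefl }

  gadgetsBob-query-port : ∀ y ν c → mate (gadgetsBob y) (ν , query c zero) ≡ nothing
  gadgetsBob-query-port y ν c = cong (Maybe.map (ν ,_) ∘ Maybe.map inj₁)
    (gadgetBob-port (paddedBob (nodeVar ν) y) (paddedBob-tap (nodeVar ν) y) c)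

  gadgetsBob-merge-port : ∀ y ν c → mate (gadgetsBob y) (ν , merge c zero) ≡ nothing
  gadgetsBob-merge-port y ν c = cong (Maybe.map (ν ,_) ∘ Maybe.map inj₂ ∘ Maybe.map inj₁)
    (gadgetBob-port (paddedBob (mergeVar ν) y) (paddedBob-tap (mergeVar ν) y) c)

  gadgets-wiring-disjoint : ∀ y v → mate (gadgetsBob y) v ≡ nothing ⊎ wire v ≡ nothing
  gadgets-wiring-disjoint y (ν , query _ (suc _)) = inj₂ refl
  gadgets-wiring-disjoint y (ν , merge _ (suc _)) = inj₂ refl
  gadgets-wiring-disjoint y (ν , query c zero)    = inj₁ (gadgetsBob-query-port y ν c)
  gadgets-wiring-disjoint y (ν , merge c zero)    = inj₁ (gadgetsBob-merge-port y ν c)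
  gadgets-wiring-disjoint y (ν , rejecting b)     = inj₁ refl

  compositionBob : Y → PartialMatching Vertex
  compositionBob y = unionᴹ (gadgetsBob y) wiring (gadgets-wiring-disjoint y)

  compositionBob-port : ∀ y v → mate (gadgetsBob y) v ≡ nothing →
                        mate (compositionBob y) v ≡ wire v
  compositionBob-port y v free rewrite free = refl

  compositionGraph : X → Y → HoseGraph Vertex
  compositionGraph x y = record { aliceᴹ = gadgetsAlice x ; bobᴹ = compositionBob y }

  module _ (x : X) (y : Y) where

    private
      G = compositionGraph x y

      z : Fin k → Bool
      z i = ghOutput (Pr i) x y

    open Run z

    Traversal : Node → (Copy × Fin (suc M) → Block) → Fin k → Set
    Traversal ν slot i =
      ∃[ m ] Walk G true (ν , slot (run , zero)) m false (ν , slot (out (z i) , zero)) × odd m ≡ true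

    slotTraversal : ∀ ν i (slot : Copy × Fin (suc M) → Block) →
                    (∀ t {q q′} → edge (gadgetGraph (paddedGraph i x y)) t q ≡ just q′ →
                                  edge G t (ν , slot q) ≡ just (ν , slot q′)) →
                    Traversal ν slot i
    slotTraversal ν i slot hom with paddedWalk i x y
    ... | n , w , output with gadget-traversal (paddedGraph i x y) (paddedBob-tap i y) w
    ...   | m , p , odd-m =
      m , subst (λ b → Walk G true _ m false (ν , slot (out b , zero))) (sym output)
                (mapWalk (λ q → ν , slot q) hom p)
        , odd-m

    queryTraversal : ∀ ν → Traversal ν inj₁ (nodeVar ν)
    queryTraversal ν = slotTraversal ν (nodeVar ν) inj₁ λ
      { true  eq → cong (Maybe.map (ν ,_) ∘ Maybe.map inj₁) eq
      ; false {q} eq → cong (λ m → Maybe.map (ν ,_) (Maybe.map inj₁ m) <∣> wire (ν , inj₁ q)) eq }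

    mergeTraversal : ∀ ν → Traversal ν (inj₂ ∘ inj₁) (mergeVar ν)
    mergeTraversal ν = slotTraversal ν (mergeVar ν) (inj₂ ∘ inj₁) λ
      { true  eq → cong (Maybe.map (ν ,_) ∘ Maybe.map inj₂ ∘ Maybe.map inj₁) eq
      ; false {q} eq →
          cong (λ m → Maybe.map (ν ,_) (Maybe.map inj₂ (Maybe.map inj₁ m)) <∣> wire (ν , inj₂ (inj₁ q))) eq }

    exitEdge : ∀ {ν b r} → δN ν b ≡ r → edge G false (ν , query (out b) zero) ≡ exitPort ν b r
    exitEdge {ν} {b} ν→ =
      trans (compositionBob-port y (ν , query (out b) zero) (gadgetsBob-query-port y ν (out b)))
            (cong (exitPort ν b) ν→)

    enterEdge : ∀ {μ b ν} → δN μ b ≡ inj₁ ν →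
                edge G false (ν , merge run zero) ≡ just (ν , query run zero)
    enterEdge {ν = ν} μ→ν with δN-successor μ→ν
    ... | _ , _ , refl = compositionBob-port y (ν , merge run zero) (gadgetsBob-merge-port y ν run)

    advance : ∀ {ν ν′} → δN ν (z (nodeVar ν)) ≡ inj₁ ν′ →
              ∃[ m ] Walk G true (ν , query run zero) m true (ν′ , query run zero) × odd m ≡ false
    advance {ν} {ν′} ν→ν′ with queryTraversal ν | mergeTraversal ν′
    ... | m₁ , p₁ , odd-m₁ | m₂ , p₂ , odd-m₂ =
      m₁ + suc (suc m₂) , p₁ ++ (exitEdge ν→ν′ ∷ (reverse p₂′ ∷ʳ enterEdge ν→ν′)) ,
      trans (odd-+ m₁ (suc (suc m₂))) (cong₂ (λ a c → a xor not (not c)) odd-m₁ odd-m₂)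
      where
      p₂′ : Walk G true (ν′ , merge run zero) m₂ false (ν′ , merge (out (z (nodeVar ν))) zero)
      p₂′ = subst (λ i → Walk G true _ m₂ false (ν′ , merge (out (z i)) zero)) (mergeVar-δN ν→ν′) p₂

    runWalk : ∀ f ν → suc (L P) ≤ layer ν + f →
              ∃[ n ] MaximalWalk G true (ν , query run zero) n × odd n ≡ runFrom f ν
    runWalk zero ν bound =
      ⊥-elim (1+n≰n (≤-trans bound (≤-trans (≤-reflexive (+-identityʳ _)) (layer-≤ ν))))
    runWalk (suc f) ν bound rewrite runFrom-suc f ν
      with δN ν (z (nodeVar ν)) in ν→ | queryTraversal ν
    ... | inj₂ true  | m , p , odd-m = m , maximal p (exitEdge ν→) , odd-m
    ... | inj₂ false | m , p , odd-m = suc m , maximal (p ∷ʳ exitEdge ν→) refl , cong not odd-m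
    ... | inj₁ ν′    | _ with advance ν→ | runWalk f ν′ bound′
      where bound′ = subst (suc (L P) ≤_) (trans (+-suc _ f) (cong (_+ f) (sym (layer-δN ν→)))) bound
    ...   | m , p , even-m | n , maximal q stuck , odd-n =
      m + n , maximal (p ++ q) stuck , trans (odd-+ m n) (cong₂ _xor_ even-m odd-n)

  Block↔Fin : Block ↔ Fin (3 * suc M + (3 * suc M + 2))
  Block↔Fin = ↔-trans (gadget↔Fin ⊎-↔ (gadget↔Fin ⊎-↔ ↔-sym 2↔Bool))
                      (↔-trans (↔-refl ⊎-↔ ↔-sym +↔⊎) (↔-sym +↔⊎))
    where
    gadget↔Fin : (Copy × Fin (suc M)) ↔ Fin (3 * suc M)
    gadget↔Fin = ↔-trans (Copy↔Fin ×-↔ ↔-refl) (↔-sym *↔×)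

  vertexCount : ℕ
  vertexCount = (1 + L P * w P) * (3 * suc M + (3 * suc M + 2))

  Vertex↔Fin : Vertex ↔ Fin (suc (pred vertexCount))
  Vertex↔Fin = ↔-trans (Node↔Fin ×-↔ Block↔Fin) (↔-sym *↔×)

  open Realization Vertex↔Fin tap refl gadgetsAlice compositionBob
    (λ y → compositionBob-port y tap (gadgetsBob-query-port y source run))
    using (protocol; ghOutput-protocol) public

  protocol-correct : ∀ x y → ghOutput protocol x y ≡ pbpEval P (λ i → ghOutput (Pr i) x y)
  protocol-correct x y with runWalk x y (suc (L P)) source ≤-refl
  ... | n , w , parity = trans (ghOutput-protocol w) parity

maxFin-≤ : ∀ {k} (c : Fin k → ℕ) i → c i ≤ maxFin c
maxFin-≤ c zero    = m≤m⊔n (c zero) _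
maxFin-≤ c (suc i) = ≤-trans (maxFin-≤ (λ j → c (suc j)) i) (m≤n⊔m (c zero) _)

pbpRun-cong : ∀ {k} (P : PBP k) {z z′} → (∀ i → z i ≡ z′ i) →
              ∀ f j u → pbpRun P z f j u ≡ pbpRun P z′ f j u
pbpRun-cong P z≗z′ zero    j u = refl
pbpRun-cong P {z} {z′} z≗z′ (suc f) j u with j ≤? L P
... | no _  = refl
... | yes j≤L rewrite z≗z′ (var P j j≤L) with δ P j j≤L (z′ (var P j j≤L)) u
...   | inj₂ _ = refl
...   | inj₁ v = pbpRun-cong P z≗z′ f (suc j) v

ghOutput-size0 : (P : GHProtocol X Y) → size P ≡ 0 → ∀ x y → ghOutput P x y ≡ false
ghOutput-size0 P size≡0 x y = no-alice-edge (alice P x) (bob P y) size≡0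
  where
  no-alice-edge : ∀ {s} (mA : Matching (suc s)) (mB : Matching s) → s ≡ 0 →
                  odd (pathLen mA mB (suc s) true zero) ≡ false
  no-alice-edge mA mB refl with partner mA zero in loop
  ... | nothing   = refl
  ... | just zero = ⊥-elim (partner-irrefl mA zero loop)

constantProtocol : Bool → GHProtocol X Y
constantProtocol false = record
  { size = 0 ; alice = λ _ → toMatching emptyᴹ ; bob = λ _ → toMatching emptyᴹ }
constantProtocol true  = record
  { size = 1 ; alice = λ _ → tap–pipe ; bob = λ _ → toMatching emptyᴹ }
  where
  tap–pipe : Matching 2
  tap–pipe = record { partner = other ; partner-sym = other-sym ; partner-irrefl = other-irrefl }
    where
    other : Fin 2 → Maybe (Fin 2)
    other zero       = just (suc zero)
    other (suc zero) = just zero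

    other-sym : ∀ u v → other u ≡ just v → other v ≡ just u
    other-sym zero       _ refl = refl
    other-sym (suc zero) _ refl = refl

    other-irrefl : ∀ u → other u ≢ just u
    other-irrefl zero       ()
    other-irrefl (suc zero) ()

constantProtocol-output : ∀ b (x : X) (y : Y) → ghOutput (constantProtocol b) x y ≡ b
constantProtocol-output false x y = refl
constantProtocol-output true  x y = refl

constantProtocol-size : ∀ b → size (constantProtocol {X} {Y} b) ≤ 1
constantProtocol-size false = z≤n
constantProtocol-size true  = s≤s z≤n

composition-size : ∀ N M → pred (N * (3 * suc (suc M) + (3 * suc (suc M) + 2))) ≤ 14 * (N + 2) * suc M + 1
composition-size N M = begin
  pred (N * block)        ≤⟨ pred[n]≤n ⟩
  N * block               ≤⟨ *-monoʳ-≤ N block≤ ⟩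
  N * (14 * M + 14)       ≤⟨ *-monoˡ-≤ (14 * M + 14) (m≤m+n N 2) ⟩
  (N + 2) * (14 * M + 14) ≡⟨ regroup ⟩
  14 * (N + 2) * suc M    ≤⟨ m≤m+n _ 1 ⟩
  14 * (N + 2) * suc M + 1 ∎
  where
  open ≤-Reasoning
  open +-*-Solver
  block = 3 * suc (suc M) + (3 * suc (suc M) + 2)

  block≤ : block ≤ 14 * M + 14
  block≤ = begin
    block       ≡⟨ solve 1 (λ M → con 3 :* (con 2 :+ M) :+ (con 3 :* (con 2 :+ M) :+ con 2)
                                  := con 6 :* M :+ con 14) refl M ⟩
    6 * M + 14  ≤⟨ +-monoˡ-≤ 14 (*-monoˡ-≤ M (m≤m+n 6 8)) ⟩
    14 * M + 14 ∎

  regroup : (N + 2) * (14 * M + 14) ≡ 14 * (N + 2) * suc M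
  regroup = solve 2 (λ N M → (N :+ con 2) :* (con 14 :* M :+ con 14)
                             := con 14 :* (N :+ con 2) :* (con 1 :+ M)) refl N M

composition-protocol : ∀ {k} (P : PBP k) (Pr : Fin k → GHProtocol X Y) M → (∀ i → size (Pr i) ≤ M) →
  Σ (GHProtocol X Y) λ Q → (∀ x y → ghOutput Q x y ≡ pbpEval P (λ i → ghOutput (Pr i) x y))
                          × size Q ≤ 14 * pbpSize P * M + 1
composition-protocol {X} {Y} P Pr zero size≤ = constantProtocol value , correct , size-bound
  where
  value = pbpEval P (λ _ → false)

  correct : ∀ x y → ghOutput (constantProtocol value) x y ≡ pbpEval P (λ i → ghOutput (Pr i) x y)
  correct x y = trans (constantProtocol-output value x y)
    (pbpRun-cong P (λ i → sym (ghOutput-size0 (Pr i) (n≤0⇒n≡0 (size≤ i)) x y)) _ 0 zero)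

  size-bound : size (constantProtocol {X} {Y} value) ≤ 14 * pbpSize P * 0 + 1
  size-bound = subst (λ c → size (constantProtocol {X} {Y} value) ≤ c + 1) (sym (*-zeroʳ (14 * pbpSize P)))
                     (constantProtocol-size {X} {Y} value)
composition-protocol P Pr (suc M) size≤ =
  protocol , protocol-correct , composition-size (1 + L P * w P) M
  where open Composition P (suc M) Pr size≤

reindex : ∀ {n NA NB} → GHProtocol (Fin n → Bool) (Fin n → Bool) →
          (Fin n → Fin NA) → (Fin n → Fin NB) → GHProtocol (Fin NA → Bool) (Fin NB → Bool)
reindex Q a b = record { size = size Q ; alice = λ x → alice Q (x ∘ a) ; bob = λ y → bob Q (y ∘ b) }

lemma2 : ∃[ c ] ∃[ d ]
    (∀ (k n NA NB s : ℕ)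
       (g : (Fin k → Bool) → Bool)
       (f : Fin k → (Fin n → Bool) → (Fin n → Bool) → Bool)
       (C : Fin k → ℕ)
       (a : Fin k → Fin n → Fin NA)
       (b : Fin k → Fin n → Fin NB) →
       (∀ i → Injective _≡_ _≡_ (a i)) →
       (∀ i → Injective _≡_ _≡_ (b i)) →
       PBPis g s →
       (∀ i → GHis (f i) (C i)) →
       Σ (GHProtocol (Fin NA → Bool) (Fin NB → Bool))
         (λ P → GHComputes P (compose g f a b)
                × size P ≤ c * s * maxFin C + d))
lemma2 = 14 , 1 , λ where
  k n NA NB s g f C a b _ _ ((P , P-computes , P-size) , _) GH →
    let Pr : Fin k → GHProtocol (Fin NA → Bool) (Fin NB → Bool)
        Pr i = reindex (proj₁ (proj₁ (GH i))) (a i) (b i)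
        Pr-computes : ∀ i x y → ghOutput (Pr i) x y ≡ f i (x ∘ a i) (y ∘ b i)
        Pr-computes i x y = proj₁ (proj₂ (proj₁ (GH i))) (x ∘ a i) (y ∘ b i)
        Pr-size : ∀ i → size (Pr i) ≤ maxFin C
        Pr-size i = subst (_≤ maxFin C) (sym (proj₂ (proj₂ (proj₁ (GH i))))) (maxFin-≤ C i)
        (Q , Q-correct , Q-size) = composition-protocol P Pr (maxFin C) Pr-size
    in Q
     , (λ x y → trans (Q-correct x y) (trans (pbpRun-cong P (λ i → Pr-computes i x y) _ 0 zero)
                                             (P-computes _)))
     , subst (λ s → size Q ≤ 14 * s * maxFin C + 1) P-size Q-size
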